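{- Let $G=(P,E)$ be a finite graph. Consider the following sequential procedure: the nodes are processed in non-increasing order of their degrees (ties broken arbitrarily), and when node $p$ of degree $d$ is processed, with $j=\lceil \log (d+1)\rceil$, it picks an integer $x\in[0,2^j-1]$ such that no already-processed neighbor of $p$ has picked an integer $x'$ with $x\equiv x' \pmod{2^j}$. Node $p$ with picked integer $x_p$ and $j_p=\lceil\log(d_p+1)\rceil$ hosts (is happy at) holiday $t$ iff $t\equiv x_p\pmod{2^{j_p}}$. Let $p_1,p_2$ be adjacent nodes with degrees $d_1,d_2$, let $j_1=\lceil \log (d_1+1)\rceil$, $j_2=\lceil \log (d_2+1)\rceil$, and let $x_1,x_2$ be the integers picked by $p_1,p_2$ by this procedure. Then there is no integer $t$ with $t\equiv x_1 \pmod{2^{j_1}}$ and $t\equiv x_2\pmod{2^{j_2}}$, i.e., $p_1$ and $p_2$ never host during the same holiday.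
   Context: Logarithms are base 2. The degree of a node is its number of neighbors in $G$. -}

module Defs where

open import Data.Nat using (ℕ; _^_; _<_; _≤_; suc)
open import Data.Nat.Logarithm using (⌈log₂_⌉)
open import Data.Fin using (Fin; toℕ)
open import Data.Bool using (Bool; true; false)
open import Data.List using (length; filterᵇ; allFin)
open import Data.Integer using (ℤ; +_; _-_)
open import Data.Integer.Divisibility using (_∣_)
open import Relation.Binary.PropositionalEquality using (_≡_)
open import Relation.Nullary using (¬_)
open import Function.Definitions using (Injective)

record Graph (n : ℕ) : Set where
  field
    adj   : Fin n → Fin n → Bool
    sym   : ∀ p q → adj p q ≡ adj q p
    loopless : ∀ p → adj p p ≡ false
open Graph public

degree : ∀ {n} → Graph n → Fin n → ℕ
degree G p = length (filterᵇ (adj G p) (allFin _))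

jexp : ∀ {n} → Graph n → Fin n → ℕ
jexp G p = ⌈log₂ suc (degree G p) ⌉

_≡_[mod_] : ℤ → ℤ → ℕ → Set
a ≡ b [mod m ] = (+ m) ∣ (a - b)

-- A run (outcome) of the sequential procedure: a processing order
-- (pos p = position at which p is processed; a bijection Fin n → Fin n),
-- non-increasing in degree, and the picked integers x satisfying the rule.
record Run {n : ℕ} (G : Graph n) : Set where
  field
    pos        : Fin n → Fin n
    pos-inj    : Injective _≡_ _≡_ pos
    nonincr    : ∀ p q → toℕ (pos p) < toℕ (pos q) → degree G q ≤ degree G p
    pick       : Fin n → ℕ
    pick-range : ∀ p → pick p < 2 ^ jexp G p
    pick-rule  : ∀ p q → adj G p q ≡ true → toℕ (pos q) < toℕ (pos p) →
                 ¬ ((+ pick p) ≡ (+ pick q) [mod (2 ^ jexp G p) ])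
open Run public

module Submission where

-- Of two adjacent nodes, one is processed strictly later
-- (positions are injective and a node is not its own neighbour).  Say p is
-- processed after its neighbour q.  The order is non-increasing in degree, so
-- d_p ≤ d_q and hence j_p ≤ j_q, i.e. 2^j_p divides 2^j_q.  A common holiday t
-- with t ≡ x_p (mod 2^j_p) and t ≡ x_q (mod 2^j_q) would therefore give
-- t ≡ x_q (mod 2^j_p) as well, whence x_p ≡ x_q (mod 2^j_p) -- exactly what the
-- picking rule forbids for p against its already processed neighbour q.

open import Defs
open import Data.Nat using (ℕ; _^_; _∸_; _+_; _*_; _≤_; _<_; s≤s)
open import Data.Nat.Properties using (m∸n+n≡m; ^-distribˡ-+-*; <-cmp)
open import Data.Nat.Logarithm using (⌈log₂⌉-mono-≤)
import Data.Nat.Divisibility as ℕ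
open import Data.Integer.Divisibility using () renaming (_∣_ to _∣ᵤ_)
open import Data.Fin using (Fin; toℕ)
open import Data.Fin.Properties using (toℕ-injective)
open import Data.Bool using (true)
open import Data.Integer using (ℤ; +_; _-_)
open import Data.Integer.Divisibility.Signed using (∣ᵤ⇒∣; ∣⇒∣ᵤ; ∣m∣n⇒∣m-n)
open import Data.Integer.Tactic.RingSolver using (solve-∀)
open import Data.Product using (∃; _×_; _,_)
open import Relation.Binary.Definitions using (tri<; tri≈; tri>)
open import Relation.Binary.PropositionalEquality
  using (_≡_; _≢_; refl; trans; cong; subst; module ≡-Reasoning)
  renaming (sym to ≡-sym)
open import Relation.Nullary using (¬_)

^-monoʳ-∣ : ∀ m {i j} → i ≤ j → (m ^ i) ℕ.∣ (m ^ j)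
^-monoʳ-∣ m {i} {j} i≤j = ℕ.divides (m ^ (j ∸ i)) (begin
  m ^ j               ≡⟨ cong (m ^_) (≡-sym (m∸n+n≡m i≤j)) ⟩
  m ^ (j ∸ i + i)     ≡⟨ ^-distribˡ-+-* m (j ∸ i) i ⟩
  m ^ (j ∸ i) * m ^ i ∎)
  where open ≡-Reasoning

residue-difference : ∀ (t a b : ℤ) → (t - b) - (t - a) ≡ a - b
residue-difference = solve-∀

-- If t ≡ a modulo m and t ≡ b modulo a multiple k of m, then a ≡ b modulo m:
-- the second congruence descends to m, and subtracting the two cancels t.
shared-residue : ∀ {m k : ℕ} (t a b : ℤ) → m ℕ.∣ k →
                 t ≡ a [mod m ] → t ≡ b [mod k ] → a ≡ b [mod m ]
shared-residue {m} t a b m∣k t≡a t≡b =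
  subst (λ z → (+ m) ∣ᵤ z) (residue-difference t a b)
        (∣⇒∣ᵤ (∣m∣n⇒∣m-n {+ m} {t - b} {t - a}
                  (∣ᵤ⇒∣ {+ m} {t - b} (ℕ.∣-trans m∣k t≡b)) (∣ᵤ⇒∣ {+ m} {t - a} t≡a)))

jexp-mono : ∀ {n} (G : Graph n) {p q : Fin n} →
            degree G p ≤ degree G q → jexp G p ≤ jexp G q
jexp-mono G d≤d = ⌈log₂⌉-mono-≤ (s≤s d≤d)

-- Adjacent nodes are processed at different steps: equal positions would
-- force p = q by injectivity, but no node is adjacent to itself.
adjacent-positions-differ : ∀ {n} {G : Graph n} (R : Run G) {p q : Fin n} →
                            adj G p q ≡ true → toℕ (pos R p) ≢ toℕ (pos R q)
adjacent-positions-differ {G = G} R {q = q} p~q same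
  with pos-inj R (toℕ-injective same)
... | refl with trans (≡-sym p~q) (loopless G q)
... | ()

later-neighbour-never-shares : ∀ {n} {G : Graph n} (R : Run G) {p q : Fin n} →
  adj G p q ≡ true → toℕ (pos R q) < toℕ (pos R p) → (t : ℤ) →
  t ≡ (+ pick R p) [mod (2 ^ jexp G p) ] →
  ¬ (t ≡ (+ pick R q) [mod (2 ^ jexp G q) ])
later-neighbour-never-shares {G = G} R {p} {q} p~q q-first t t≡x-p t≡x-q =
  pick-rule R p q p~q q-first
    (shared-residue t (+ pick R p) (+ pick R q) (^-monoʳ-∣ 2 j-p≤j-q) t≡x-p t≡x-q)
  where
  j-p≤j-q : jexp G p ≤ jexp G q
  j-p≤j-q = jexp-mono G (nonincr R q p q-first)

lemma1 : ∀ {n} (G : Graph n) (R : Run G) (p₁ p₂ : Fin n) → adj G p₁ p₂ ≡ true →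
    ¬ (∃ λ (t : ℤ) → (t ≡ (+ pick R p₁) [mod (2 ^ jexp G p₁) ]) × (t ≡ (+ pick R p₂) [mod (2 ^ jexp G p₂) ]))
lemma1 G R p₁ p₂ p₁~p₂ (t , t≡x₁ , t≡x₂)
  with <-cmp (toℕ (pos R p₂)) (toℕ (pos R p₁))
... | tri< p₂-first _ _ = later-neighbour-never-shares R p₁~p₂ p₂-first t t≡x₁ t≡x₂
... | tri≈ _ same _     = adjacent-positions-differ R p₁~p₂ (≡-sym same)
... | tri> _ _ p₁-first = later-neighbour-never-shares R p₂~p₁ p₁-first t t≡x₂ t≡x₁
  where
  p₂~p₁ : adj G p₂ p₁ ≡ true
  p₂~p₁ = trans (Graph.sym G p₂ p₁) p₁~p₂
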